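{- Let $L$ be a complete atomistic lattice and let $T$ be a t-norm on the bounded poset $C(L)=A(L)\cup\{0,1\}$. Then the binary operation $\overline{T}$ on $L$ defined by $$\overline{T}(x,y)=\bigvee_{u\in\kappa(x)}\ \bigvee_{v\in\kappa(y)}T(u,v),\qquad \kappa(x)=\{u\in C(L)\setminus\{0\}\mid u\le x\},$$ is a t-norm on $L$.
   Context: A lattice $L$ with bottom $0$ and top $1$ is atomistic if every element is the join of some set of atoms (elements covering $0$); $A(L)$ is the set of atoms. $C(L)=A(L)\cup\{0,1\}$ carries the order inherited from $L$. A t-norm on a bounded poset $P$ with top $1$ is a binary operation that is monotone in each argument, commutative, associative and has neutral element $1$. -}

module Defs where

open import Level using (Level; suc; Lift)
open import Data.Empty using (⊥)
open import Data.Unit using (⊤; tt)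
open import Data.Product using (Σ; _×_; _,_; proj₁; proj₂)
open import Data.Sum using (_⊎_; inj₁; inj₂)
open import Relation.Nullary using (¬_)
open import Relation.Binary.PropositionalEquality using (_≡_; refl)
open import Relation.Binary.Structures using (IsPartialOrder)

record IsTNorm {a e r : Level} {A : Set a}
               (_≈_ : A → A → Set e) (_≤_ : A → A → Set r)
               (top : A) (T : A → A → A) : Set (a Level.⊔ e Level.⊔ r) where
  field
    monoˡ : ∀ x y z → x ≤ y → T x z ≤ T y z
    monoʳ : ∀ x y z → y ≤ z → T x y ≤ T x z
    comm  : ∀ x y → T x y ≈ T y x
    assoc : ∀ x y z → T (T x y) z ≈ T x (T y z)
    identityˡ : ∀ x → T top x ≈ x
    identityʳ : ∀ x → T x top ≈ x

record CompleteLattice (ℓ : Level) : Set (suc ℓ) where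
  field
    Carrier        : Set ℓ
    _≤_            : Carrier → Carrier → Set ℓ
    isPartialOrder : IsPartialOrder _≡_ _≤_
    ⋁              : (Carrier → Set ℓ) → Carrier
    ⋁-upper        : ∀ (S : Carrier → Set ℓ) x → S x → x ≤ ⋁ S
    ⋁-least        : ∀ (S : Carrier → Set ℓ) z → (∀ x → S x → x ≤ z) → ⋁ S ≤ z

  𝟎 : Carrier
  𝟎 = ⋁ (λ _ → Lift ℓ ⊥)

  𝟏 : Carrier
  𝟏 = ⋁ (λ _ → Lift ℓ ⊤)

  IsAtom : Carrier → Set ℓ
  IsAtom u = (𝟎 ≤ u) × (¬ u ≡ 𝟎) × (∀ z → 𝟎 ≤ z → ¬ z ≡ 𝟎 → z ≤ u → z ≡ u)

  InC : Carrier → Set ℓ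
  InC u = IsAtom u ⊎ (u ≡ 𝟎 ⊎ u ≡ 𝟏)

  CL : Set ℓ
  CL = Σ Carrier InC

  _≈C_ : CL → CL → Set ℓ
  a ≈C b = proj₁ a ≡ proj₁ b

  _≤C_ : CL → CL → Set ℓ
  a ≤C b = proj₁ a ≤ proj₁ b

  𝟏C : CL
  𝟏C = 𝟏 , inj₂ (inj₂ refl)

  κ : Carrier → Carrier → Set ℓ
  κ x u = InC u × (¬ u ≡ 𝟎) × (u ≤ x)

  -- the extension  T̄(x,y) = ⋁_{u ∈ κ(x)} ⋁_{v ∈ κ(y)} T(u,v)
  extend : (CL → CL → CL) → Carrier → Carrier → Carrier
  extend T x y =
    ⋁ (λ w → Σ Carrier λ u → Σ (κ x u) λ ku →
         w ≡ ⋁ (λ w′ → Σ Carrier λ v → Σ (κ y v) λ kv →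
                   w′ ≡ proj₁ (T (u , proj₁ ku) (v , proj₁ kv))))

IsAtomistic : {ℓ : Level} → CompleteLattice ℓ → Set (suc ℓ)
IsAtomistic {ℓ} L = ∀ x → Σ (Carrier → Set ℓ) λ S → (∀ a → S a → IsAtom a) × (x ≡ ⋁ S)
  where open CompleteLattice L

{-# OPTIONS --safe #-}
module Submission where

-- Monotonicity and commutativity of T̄ are inherited term by term
-- from T, and T̄(x, y) ≤ x, y because T(u, v) ≤ u, v. Since 1 ∈ κ(1) and
-- T(1, a) = a, every atom below x lies below T̄(1, x), so atomisticity gives
-- T̄(1, x) = x. By commutativity, associativity reduces to the inequality
-- T̄(T̄(x, y), z) ≤ T̄(x, T̄(y, z)), checked on each term r = T(w, c) with
-- w ∈ κ(T̄(x, y)) and c ∈ κ(z). As r ≤ c and C(L) has height two, r = 0,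
-- or c = 1 (so z = 1 and r ≤ w ≤ T̄(x, y) = T̄(x, T̄(y, z))), or r = c. In
-- the last case c = T(w, c) ≤ T̄(y, z) because w ≤ y, so c ∈ κ(T̄(y, z)) and
-- r = T(w, c) is a term of T̄(x, T̄(y, z)) because w ≤ x.

open import Defs
open import Level using (Level; lift)
open import Data.Product using (_,_; proj₁; proj₂)
open import Data.Sum using (_⊎_; inj₁; inj₂)
open import Relation.Binary.Core using (Rel)
open import Relation.Binary.Bundles using (Poset)
import Relation.Binary.Reasoning.PartialOrder as PosetReasoning
open import Relation.Binary.Structures using (IsPreorder; IsPartialOrder)
open import Relation.Binary.PropositionalEquality using (_≡_; _≢_; refl; sym; trans; subst; cong)
import Relation.Binary.Construct.On as On

module TNormProperties {a e r : Level} {A : Set a} {_≈_ : Rel A e} {_≤_ : Rel A r}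
  {top : A} {T : A → A → A}
  (isPreorder : IsPreorder _≈_ _≤_) (≤-top : ∀ x → x ≤ top) (tn : IsTNorm _≈_ _≤_ top T)
  where
  open IsPreorder isPreorder using (reflexive) renaming (trans to ≤-trans)
  open IsTNorm tn

  T-≤ˡ : ∀ x y → T x y ≤ x
  T-≤ˡ x y = ≤-trans (monoʳ x y top (≤-top y)) (reflexive (identityʳ x))

  T-≤ʳ : ∀ x y → T x y ≤ y
  T-≤ʳ x y = ≤-trans (monoˡ x top y (≤-top x)) (reflexive (identityˡ y))

module CompleteLatticeProperties {ℓ : Level} (L : CompleteLattice ℓ) where
  open CompleteLattice L
  open IsPartialOrder isPartialOrder using (antisym)

  𝟎-≤ : ∀ x → 𝟎 ≤ x
  𝟎-≤ x = ⋁-least _ x (λ { _ (lift ()) })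

  ≤-𝟏 : ∀ x → x ≤ 𝟏
  ≤-𝟏 x = ⋁-upper _ x (lift _)

  atomistic-≤ : IsAtomistic L → ∀ {x y} → (∀ a → IsAtom a → a ≤ x → a ≤ y) → x ≤ y
  atomistic-≤ atomistic {x} {y} atoms≤y with atomistic x
  ... | S , S-atoms , refl = ⋁-least S y λ a Sa → atoms≤y a (S-atoms a Sa) (⋁-upper S a Sa)

  InC-≤-cases : ∀ {r c} → InC r → InC c → r ≤ c → r ≡ 𝟎 ⊎ r ≡ c ⊎ c ≡ 𝟏
  InC-≤-cases _                    (inj₂ (inj₂ c≡𝟏))       _   = inj₂ (inj₂ c≡𝟏)
  InC-≤-cases _                    (inj₂ (inj₁ refl))      r≤𝟎 = inj₁ (antisym r≤𝟎 (𝟎-≤ _))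
  InC-≤-cases (inj₂ (inj₁ r≡𝟎))    _                       _   = inj₁ r≡𝟎
  InC-≤-cases (inj₂ (inj₂ refl))   _                       𝟏≤c = inj₂ (inj₁ (antisym 𝟏≤c (≤-𝟏 _)))
  InC-≤-cases (inj₁ (_ , r≢𝟎 , _)) (inj₁ (_ , _ , minimal)) r≤c = inj₂ (inj₁ (minimal _ (𝟎-≤ _) r≢𝟎 r≤c))

  poset : Poset ℓ ℓ ℓ
  poset = record { isPartialOrder = isPartialOrder }

  CL-isPreorder : IsPreorder _≈C_ _≤C_
  CL-isPreorder = On.isPreorder proj₁ (IsPartialOrder.isPreorder isPartialOrder)

module ExtensionProperties {ℓ : Level} (L : CompleteLattice ℓ)
  (T : CompleteLattice.CL L → CompleteLattice.CL L → CompleteLattice.CL L) where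
  open CompleteLattice L
  open IsPartialOrder isPartialOrder using (antisym; reflexive) renaming (trans to ≤-trans)
  open CompleteLatticeProperties L

  T̄ : Carrier → Carrier → Carrier
  T̄ = extend T

  κ-mono : ∀ {x y u} → x ≤ y → κ x u → κ y u
  κ-mono x≤y (Cu , u≢𝟎 , u≤x) = Cu , u≢𝟎 , ≤-trans u≤x x≤y

  extend-upper : ∀ {x y u v} (ku : κ x u) (kv : κ y v) → proj₁ (T (u , proj₁ ku) (v , proj₁ kv)) ≤ T̄ x y
  extend-upper ku kv = ≤-trans (⋁-upper _ _ (_ , kv , refl)) (⋁-upper _ _ (_ , ku , refl))

  extend-least : ∀ {x y z} → (∀ {u v} (ku : κ x u) (kv : κ y v) → proj₁ (T (u , proj₁ ku) (v , proj₁ kv)) ≤ z) →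
                 T̄ x y ≤ z
  extend-least {z = z} terms≤z = ⋁-least _ z λ { _ (_ , ku , refl) →
                                 ⋁-least _ z λ { _ (_ , kv , refl) → terms≤z ku kv } }

  extend-monoˡ : ∀ x y z → x ≤ y → T̄ x z ≤ T̄ y z
  extend-monoˡ x y z x≤y = extend-least λ ku kv → extend-upper (κ-mono x≤y ku) kv

  extend-monoʳ : ∀ x y z → y ≤ z → T̄ x y ≤ T̄ x z
  extend-monoʳ x y z y≤z = extend-least λ ku kv → extend-upper ku (κ-mono y≤z kv)

  module _ (tn : IsTNorm _≈C_ _≤C_ 𝟏C T) where
    open IsTNorm tn using (comm; identityˡ)
    open TNormProperties CL-isPreorder (λ u → ≤-𝟏 (proj₁ u)) tn

    extend-comm : ∀ x y → T̄ x y ≡ T̄ y x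
    extend-comm x y = antisym (comm-≤ x y) (comm-≤ y x)
      where
      comm-≤ : ∀ x y → T̄ x y ≤ T̄ y x
      comm-≤ x y = extend-least λ ku kv → ≤-trans (reflexive (comm _ _)) (extend-upper kv ku)

    extend-≤ˡ : ∀ x y → T̄ x y ≤ x
    extend-≤ˡ x y = extend-least λ (_ , _ , u≤x) _ → ≤-trans (T-≤ˡ _ _) u≤x

    extend-≤ʳ : ∀ x y → T̄ x y ≤ y
    extend-≤ʳ x y = extend-least λ _ (_ , _ , v≤y) → ≤-trans (T-≤ʳ _ _) v≤y

    module _ (atomistic : IsAtomistic L) where

      extend-identityˡ : ∀ x → T̄ 𝟏 x ≡ x
      extend-identityˡ x = antisym (extend-≤ʳ 𝟏 x) (atomistic-≤ atomistic atom≤T̄𝟏x)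
        where
        atom≤T̄𝟏x : ∀ a → IsAtom a → a ≤ x → a ≤ T̄ 𝟏 x
        atom≤T̄𝟏x a a-atom@(_ , a≢𝟎 , _) a≤x =
          ≤-trans (reflexive (sym (identityˡ (a , inj₁ a-atom))))
                  (extend-upper (inj₂ (inj₂ refl) , 𝟏≢𝟎 , reflexive refl) (inj₁ a-atom , a≢𝟎 , a≤x))
          where
          𝟏≢𝟎 : 𝟏 ≢ 𝟎
          𝟏≢𝟎 𝟏≡𝟎 = a≢𝟎 (antisym (subst (a ≤_) 𝟏≡𝟎 (≤-𝟏 a)) (𝟎-≤ a))

      extend-identityʳ : ∀ x → T̄ x 𝟏 ≡ x
      extend-identityʳ x = trans (extend-comm x 𝟏) (extend-identityˡ x)

      extend-assoc-≤ : ∀ x y z → T̄ (T̄ x y) z ≤ T̄ x (T̄ y z)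
      extend-assoc-≤ x y z = extend-least term≤
        where
        term≤ : ∀ {w c} (kw : κ (T̄ x y) w) (kc : κ z c) → proj₁ (T (w , proj₁ kw) (c , proj₁ kc)) ≤ T̄ x (T̄ y z)
        term≤ {w} {c} kw@(Cw , _ , w≤T̄xy) kc@(Cc , c≢𝟎 , c≤z)
          with InC-≤-cases (proj₂ (T (w , Cw) (c , Cc))) Cc (T-≤ʳ _ _)
        ... | inj₁ r≡𝟎 = subst (_≤ T̄ x (T̄ y z)) (sym r≡𝟎) (𝟎-≤ _)
        ... | inj₂ (inj₁ r≡c) = extend-upper (κ-mono (extend-≤ˡ x y) kw) (Cc , c≢𝟎 , c≤T̄yz)
          where
          c≤T̄yz : c ≤ T̄ y z
          c≤T̄yz = subst (_≤ T̄ y z) r≡c (extend-upper (κ-mono (extend-≤ʳ x y) kw) kc)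
        ... | inj₂ (inj₂ refl) = ≤-trans (T-≤ˡ _ _) (≤-trans w≤T̄xy (reflexive (cong (T̄ x) y≡T̄yz)))
          where
          y≡T̄yz : y ≡ T̄ y z
          y≡T̄yz = trans (sym (extend-identityʳ y)) (cong (T̄ y) (antisym c≤z (≤-𝟏 z)))

      extend-assoc : ∀ x y z → T̄ (T̄ x y) z ≡ T̄ x (T̄ y z)
      extend-assoc x y z = antisym (extend-assoc-≤ x y z) (begin
        T̄ x (T̄ y z) ≡⟨ extend-comm x (T̄ y z) ⟩
        T̄ (T̄ y z) x ≤⟨ extend-assoc-≤ y z x ⟩
        T̄ y (T̄ z x) ≡⟨ extend-comm y (T̄ z x) ⟩
        T̄ (T̄ z x) y ≤⟨ extend-assoc-≤ z x y ⟩
        T̄ z (T̄ x y) ≡⟨ extend-comm z (T̄ x y) ⟩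
        T̄ (T̄ x y) z ∎)
        where open PosetReasoning poset

theorem3p2 : {ℓ : Level} (L : CompleteLattice ℓ) → IsAtomistic L →
    (T : CompleteLattice.CL L → CompleteLattice.CL L → CompleteLattice.CL L) →
    IsTNorm (CompleteLattice._≈C_ L) (CompleteLattice._≤C_ L) (CompleteLattice.𝟏C L) T →
    IsTNorm _≡_ (CompleteLattice._≤_ L) (CompleteLattice.𝟏 L) (CompleteLattice.extend L T)
theorem3p2 L atomistic T tn = record
  { monoˡ     = extend-monoˡ
  ; monoʳ     = extend-monoʳ
  ; comm      = extend-comm tn
  ; assoc     = extend-assoc tn atomistic
  ; identityˡ = extend-identityˡ tn atomistic
  ; identityʳ = extend-identityʳ tn atomistic
  }
  where open ExtensionProperties L T
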